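{- Let $\lambda\in\mathsf{O}$ be a zero of $x^2+x+2$. Then $\mathsf{O}\lambda\cap\mathsf{O}\overline{\lambda}=2\mathsf{O}$.
   Context: $\mathbb{O}$ is the real octonion algebra with norm $N(x)=x\overline{x}$ and conjugation $x\mapsto\overline{x}$. Fix a basic triple $(i,j,l)$ (imaginary units with $i\perp j$, $l\perp 1,i,j,ij$), set $i_0=-(ij)l$, $i_1=il$, $i_2=i$, $i_3=j$, $i_4=l$, $i_5=ij$, $i_6=jl$, and $\omega_r=\frac12(-1+i_0+i_r+i_{3r})$ for $r\in\{1,2,4\}$ (indices mod 7); $\mathsf{O}$ is the subring of $\mathbb{O}$ generated by $\omega_1,\omega_2,\omega_4$ (the octavian integers). $\mathsf{O}s=\{xs:x\in\mathsf{O}\}$. -}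

module Defs where

open import Data.Rational as Q using (ℚ; 0ℚ; 1ℚ; ½)
open import Data.Product using (Σ; _×_; _,_)
open import Relation.Binary.PropositionalEquality using (_≡_)

record ℍ : Set where
  constructor quat
  field
    re ii jj kk : ℚ

infixl 6 _+ᴴ_ _-ᴴ_
infixl 7 _*ᴴ_

_+ᴴ_ : ℍ → ℍ → ℍ
quat a b c d +ᴴ quat a' b' c' d' = quat (a Q.+ a') (b Q.+ b') (c Q.+ c') (d Q.+ d')

-ᴴ_ : ℍ → ℍ
-ᴴ quat a b c d = quat (Q.- a) (Q.- b) (Q.- c) (Q.- d)

_-ᴴ_ : ℍ → ℍ → ℍ
x -ᴴ y = x +ᴴ (-ᴴ y)

_*ᴴ_ : ℍ → ℍ → ℍ
quat a1 b1 c1 d1 *ᴴ quat a2 b2 c2 d2 =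
  quat (a1 Q.* a2 Q.- b1 Q.* b2 Q.- c1 Q.* c2 Q.- d1 Q.* d2)
       (a1 Q.* b2 Q.+ b1 Q.* a2 Q.+ c1 Q.* d2 Q.- d1 Q.* c2)
       (a1 Q.* c2 Q.- b1 Q.* d2 Q.+ c1 Q.* a2 Q.+ d1 Q.* b2)
       (a1 Q.* d2 Q.+ b1 Q.* c2 Q.- c1 Q.* b2 Q.+ d1 Q.* a2)

conjᴴ : ℍ → ℍ
conjᴴ (quat a b c d) = quat a (Q.- b) (Q.- c) (Q.- d)

0ᴴ 1ᴴ iᴴ jᴴ : ℍ
0ᴴ = quat 0ℚ 0ℚ 0ℚ 0ℚ
1ᴴ = quat 1ℚ 0ℚ 0ℚ 0ℚ
iᴴ = quat 0ℚ 1ℚ 0ℚ 0ℚ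
jᴴ = quat 0ℚ 0ℚ 1ℚ 0ℚ

-- Octonions (with rational coordinates) by the Cayley–Dickson doubling
-- 𝕆 = ℍ ⊕ ℍ·l :  (a , b) stands for a + b·l.
record 𝕆 : Set where
  constructor oct
  field
    fst snd : ℍ

infixl 6 _+_ _-_
infixl 7 _*_

_+_ : 𝕆 → 𝕆 → 𝕆
oct a b + oct c d = oct (a +ᴴ c) (b +ᴴ d)

-_ : 𝕆 → 𝕆
- oct a b = oct (-ᴴ a) (-ᴴ b)

_-_ : 𝕆 → 𝕆 → 𝕆
x - y = x + (- y)

_*_ : 𝕆 → 𝕆 → 𝕆
oct a b * oct c d = oct (a *ᴴ c -ᴴ conjᴴ d *ᴴ b) (d *ᴴ a +ᴴ b *ᴴ conjᴴ c)

conj : 𝕆 → 𝕆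
conj (oct a b) = oct (conjᴴ a) (-ᴴ b)

scalar : ℚ → 𝕆
scalar q = oct (quat q 0ℚ 0ℚ 0ℚ) 0ᴴ

𝟘 𝟙 𝟚 : 𝕆
𝟘 = scalar 0ℚ
𝟙 = scalar 1ℚ
𝟚 = scalar (1ℚ Q.+ 1ℚ)

i j l : 𝕆
i = oct iᴴ 0ᴴ
j = oct jᴴ 0ᴴ
l = oct 0ᴴ 1ᴴ

i₀ i₁ i₂ i₃ i₄ i₅ i₆ : 𝕆
i₀ = - ((i * j) * l)
i₁ = i * l
i₂ = i
i₃ = j
i₄ = l
i₅ = i * j
i₆ = j * l

-- ω_r = ½(−1 + i₀ + i_r + i_{3r}),  r ∈ {1,2,4}  (3·1=3, 3·2=6, 3·4=12≡5)
ω₁ ω₂ ω₄ : 𝕆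
ω₁ = scalar ½ * (- 𝟙 + i₀ + i₁ + i₃)
ω₂ = scalar ½ * (- 𝟙 + i₀ + i₂ + i₆)
ω₄ = scalar ½ * (- 𝟙 + i₀ + i₄ + i₅)

data InO : 𝕆 → Set where
  gen₁ : InO ω₁
  gen₂ : InO ω₂
  gen₄ : InO ω₄
  one  : InO 𝟙
  neg  : ∀ {x} → InO x → InO (- x)
  add  : ∀ {x y} → InO x → InO y → InO (x + y)
  mul  : ∀ {x y} → InO x → InO y → InO (x * y)

_∈𝖮·_ : 𝕆 → 𝕆 → Set
z ∈𝖮· s = Σ 𝕆 λ x → InO x × z ≡ x * s

{-# OPTIONS --safe #-}
module Submission where

-- Every octonion satisfies λ² = tr(λ) λ − N(λ), so λ² + λ + 2 = (tr(λ) + 1) λ + 2 − N(λ).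
-- For a root, tr(λ) ≠ −1 would make λ real, impossible as x² + x + 2 = (x + ½)² + 7/4
-- has no rational root; hence tr(λ) = −1 and N(λ) = 2, so λ̄ = −1 − λ lies in 𝖮 and
-- λλ̄ = λ̄λ = 2.  The identities (xλ)λ̄ = (xλ̄)λ = 2x give 2𝖮 ⊆ 𝖮λ ∩ 𝖮λ̄; conversely
-- z = aλ = bλ̄ gives zλ̄ = 2a and zλ = 2b, hence z = −z(λ̄ + λ) = −2(a + b).

open import Data.Empty using (⊥-elim)
open import Data.Fin using (Fin; #_; _↑ˡ_; _↑ʳ_)
open import Data.Integer using (+_)
open import Data.Nat using (ℕ)
open import Data.Product using (_×_; _,_; proj₁; proj₂; uncurry)
open import Data.Rational as Q using (ℚ; 0ℚ; 1ℚ; ½; _≟_)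
import Data.Rational.Properties as ℚ
open import Data.Rational.Solver using (module +-*-Solver)
open import Data.Sum using (inj₁; inj₂)
open import Data.Vec using (Vec; []; _∷_; _++_)
open import Function using (id; _∘_)
open import Function.Bundles using (_⇔_; mk⇔)
open import Relation.Binary.PropositionalEquality
open import Relation.Nullary using (yes; no)
open import Algebra.Properties.Group ℚ.+-0-group using (x∙y⁻¹≈ε⇒x≈y)

open import Defs

open +-*-Solver using (Polynomial; con; var; _:+_; _:*_; :-_; _:-_; ⟦_⟧; ⟦_⟧↓; correct)

2ℚ : ℚ
2ℚ = 1ℚ Q.+ 1ℚ

re : 𝕆 → ℚ
re (oct (quat a _ _ _) _) = a

tr : 𝕆 → ℚ
tr y = re y Q.+ re y

N : 𝕆 → ℚ
N (oct (quat a b c d) (quat e f g k)) =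
  a Q.* a Q.+ b Q.* b Q.+ c Q.* c Q.+ d Q.* d Q.+ e Q.* e Q.+ f Q.* f Q.+ g Q.* g Q.+ k Q.* k

infixr 7 _·_

_·_ : ℚ → 𝕆 → 𝕆
t · oct (quat a b c d) (quat e f g k) =
  oct (quat (t Q.* a) (t Q.* b) (t Q.* c) (t Q.* d)) (quat (t Q.* e) (t Q.* f) (t Q.* g) (t Q.* k))

coordinates : 𝕆 → Vec ℚ 8
coordinates (oct (quat a b c d) (quat e f g k)) = a ∷ b ∷ c ∷ d ∷ e ∷ f ∷ g ∷ k ∷ []

quat-cong : ∀ {a b c d a′ b′ c′ d′} → a ≡ a′ → b ≡ b′ → c ≡ c′ → d ≡ d′ →
            quat a b c d ≡ quat a′ b′ c′ d′
quat-cong refl refl refl refl = refl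

-- Each operation copies the one of
-- Defs clause by clause, so evaluating a symbolic expression is definitionally
-- the corresponding expression over 𝕆, and an octonion identity reduces to the
-- ring solver's normal forms of its eight coordinates.
module Symbolic {n : ℕ} where

  data ℍₚ : Set where
    quatₚ : (a b c d : Polynomial n) → ℍₚ

  data 𝕆ₚ : Set where
    octₚ : (a b : ℍₚ) → 𝕆ₚ

  infixl 6 _+ₕ_ _+ₚ_
  infixl 7 _*ₕ_ _*ₚ_
  infixr 7 _·ₚ_

  _+ₕ_ : ℍₚ → ℍₚ → ℍₚ
  quatₚ a b c d +ₕ quatₚ a′ b′ c′ d′ = quatₚ (a :+ a′) (b :+ b′) (c :+ c′) (d :+ d′)

  -ₕ_ : ℍₚ → ℍₚ
  -ₕ quatₚ a b c d = quatₚ (:- a) (:- b) (:- c) (:- d)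

  _*ₕ_ : ℍₚ → ℍₚ → ℍₚ
  quatₚ a₁ b₁ c₁ d₁ *ₕ quatₚ a₂ b₂ c₂ d₂ =
    quatₚ (a₁ :* a₂ :- b₁ :* b₂ :- c₁ :* c₂ :- d₁ :* d₂)
          (a₁ :* b₂ :+ b₁ :* a₂ :+ c₁ :* d₂ :- d₁ :* c₂)
          (a₁ :* c₂ :- b₁ :* d₂ :+ c₁ :* a₂ :+ d₁ :* b₂)
          (a₁ :* d₂ :+ b₁ :* c₂ :- c₁ :* b₂ :+ d₁ :* a₂)

  conjₕ : ℍₚ → ℍₚ
  conjₕ (quatₚ a b c d) = quatₚ a (:- b) (:- c) (:- d)

  _+ₚ_ : 𝕆ₚ → 𝕆ₚ → 𝕆ₚ
  octₚ a b +ₚ octₚ c d = octₚ (a +ₕ c) (b +ₕ d)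

  -ₚ_ : 𝕆ₚ → 𝕆ₚ
  -ₚ octₚ a b = octₚ (-ₕ a) (-ₕ b)

  _*ₚ_ : 𝕆ₚ → 𝕆ₚ → 𝕆ₚ
  octₚ a b *ₚ octₚ c d = octₚ (a *ₕ c +ₕ -ₕ (conjₕ d *ₕ b)) (d *ₕ a +ₕ b *ₕ conjₕ c)

  conjₚ : 𝕆ₚ → 𝕆ₚ
  conjₚ (octₚ a b) = octₚ (conjₕ a) (-ₕ b)

  scalarₚ : Polynomial n → 𝕆ₚ
  scalarₚ q = octₚ (quatₚ q 0ₚ 0ₚ 0ₚ) (quatₚ 0ₚ 0ₚ 0ₚ 0ₚ)
    where
    0ₚ : Polynomial n
    0ₚ = con 0ℚ

  𝟙ₚ : 𝕆ₚ
  𝟙ₚ = scalarₚ (con 1ℚ)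

  trₚ : 𝕆ₚ → Polynomial n
  trₚ (octₚ (quatₚ a _ _ _) _) = a :+ a

  Nₚ : 𝕆ₚ → Polynomial n
  Nₚ (octₚ (quatₚ a b c d) (quatₚ e f g k)) =
    a :* a :+ b :* b :+ c :* c :+ d :* d :+ e :* e :+ f :* f :+ g :* g :+ k :* k

  _·ₚ_ : Polynomial n → 𝕆ₚ → 𝕆ₚ
  t ·ₚ octₚ (quatₚ a b c d) (quatₚ e f g k) =
    octₚ (quatₚ (t :* a) (t :* b) (t :* c) (t :* d)) (quatₚ (t :* e) (t :* f) (t :* g) (t :* k))

  octVar : (Fin 8 → Fin n) → 𝕆ₚ
  octVar ι = octₚ (quatₚ (v (# 0)) (v (# 1)) (v (# 2)) (v (# 3)))
                  (quatₚ (v (# 4)) (v (# 5)) (v (# 6)) (v (# 7)))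
    where
    v : Fin 8 → Polynomial n
    v = var ∘ ι

  mapₚ : (Polynomial n → ℚ) → 𝕆ₚ → 𝕆
  mapₚ φ (octₚ (quatₚ a b c d) (quatₚ e f g k)) =
    oct (quat (φ a) (φ b) (φ c) (φ d)) (quat (φ e) (φ f) (φ g) (φ k))

  mapₚ-cong : ∀ {φ ψ} → (∀ p → φ p ≡ ψ p) → ∀ x → mapₚ φ x ≡ mapₚ ψ x
  mapₚ-cong φ≗ψ (octₚ (quatₚ a b c d) (quatₚ e f g k)) =
    cong₂ oct (quat-cong (φ≗ψ a) (φ≗ψ b) (φ≗ψ c) (φ≗ψ d)) (quat-cong (φ≗ψ e) (φ≗ψ f) (φ≗ψ g) (φ≗ψ k))

  evaluate normalise : 𝕆ₚ → Vec ℚ n → 𝕆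
  evaluate x ρ = mapₚ (λ p → ⟦ p ⟧ ρ) x
  normalise x ρ = mapₚ (λ p → ⟦ p ⟧↓ ρ) x

  octonion-identity : ∀ ρ x y → normalise x ρ ≡ normalise y ρ → evaluate x ρ ≡ evaluate y ρ
  octonion-identity ρ x y nf-x≡nf-y = begin
    evaluate x ρ   ≡⟨ mapₚ-cong (λ p → sym (correct p ρ)) x ⟩
    normalise x ρ  ≡⟨ nf-x≡nf-y ⟩
    normalise y ρ  ≡⟨ mapₚ-cong (λ p → correct p ρ) y ⟩
    evaluate y ρ   ∎
    where open ≡-Reasoning

open Symbolic

X₁ : 𝕆ₚ {8}
X₁ = octVar id

X₂ Y₂ : 𝕆ₚ {16}
X₂ = octVar (_↑ˡ 8)
Y₂ = octVar (8 ↑ʳ_)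

X₃ Y₃ Z₃ : 𝕆ₚ {24}
X₃ = octVar (_↑ˡ 16)
Y₃ = octVar ((8 ↑ʳ_) ∘ (_↑ˡ 8))
Z₃ = octVar (16 ↑ʳ_)

*-identityʳ : ∀ x → x * 𝟙 ≡ x
*-identityʳ x = octonion-identity (coordinates x) (X₁ *ₚ 𝟙ₚ) X₁ refl

*-distribˡ-+ : ∀ x y z → x * (y + z) ≡ x * y + x * z
*-distribˡ-+ x y z = octonion-identity (coordinates x ++ coordinates y ++ coordinates z)
  (X₃ *ₚ (Y₃ +ₚ Z₃)) (X₃ *ₚ Y₃ +ₚ X₃ *ₚ Z₃) refl

*-distribʳ-+ : ∀ x y z → (x + y) * z ≡ x * z + y * z
*-distribʳ-+ x y z = octonion-identity (coordinates x ++ coordinates y ++ coordinates z)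
  ((X₃ +ₚ Y₃) *ₚ Z₃) (X₃ *ₚ Z₃ +ₚ Y₃ *ₚ Z₃) refl

-‿distribˡ-* : ∀ x y → - (x * y) ≡ - x * y
-‿distribˡ-* x y = octonion-identity (coordinates x ++ coordinates y)
  (-ₚ (X₂ *ₚ Y₂)) (-ₚ X₂ *ₚ Y₂) refl

-‿distribʳ-* : ∀ x y → - (x * y) ≡ x * - y
-‿distribʳ-* x y = octonion-identity (coordinates x ++ coordinates y)
  (-ₚ (X₂ *ₚ Y₂)) (X₂ *ₚ -ₚ Y₂) refl

scalar-* : ∀ p q → scalar p * scalar q ≡ scalar (p Q.* q)
scalar-* p q = octonion-identity (p ∷ q ∷ [])
  (scalarₚ (var (# 0)) *ₚ scalarₚ (var (# 1))) (scalarₚ (var (# 0) :* var (# 1))) refl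

x*y*ȳ≡x*Ny : ∀ x y → x * y * conj y ≡ x * scalar (N y)
x*y*ȳ≡x*Ny x y = octonion-identity (coordinates x ++ coordinates y)
  (X₂ *ₚ Y₂ *ₚ conjₚ Y₂) (X₂ *ₚ scalarₚ (Nₚ Y₂)) refl

x*ȳ*y≡x*Ny : ∀ x y → x * conj y * y ≡ x * scalar (N y)
x*ȳ*y≡x*Ny x y = octonion-identity (coordinates x ++ coordinates y)
  (X₂ *ₚ conjₚ Y₂ *ₚ Y₂) (X₂ *ₚ scalarₚ (Nₚ Y₂)) refl

ȳ≡tr-y : ∀ y → conj y ≡ scalar (tr y) - y
ȳ≡tr-y y = octonion-identity (coordinates y) (conjₚ X₁) (scalarₚ (trₚ X₁) +ₚ -ₚ X₁) refl

ȳ+y≡tr : ∀ y → conj y + y ≡ scalar (tr y)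
ȳ+y≡tr y = octonion-identity (coordinates y) (conjₚ X₁ +ₚ X₁) (scalarₚ (trₚ X₁)) refl

y²+y+2≡[tr+1]y+[2-N] : ∀ y → y * y + y + 𝟚 ≡ (tr y Q.+ 1ℚ) · y + scalar (2ℚ Q.- N y)
y²+y+2≡[tr+1]y+[2-N] y = octonion-identity (coordinates y)
  (X₁ *ₚ X₁ +ₚ X₁ +ₚ scalarₚ (con 2ℚ))
  ((trₚ X₁ :+ con 1ℚ) ·ₚ X₁ +ₚ scalarₚ (con 2ℚ :- Nₚ X₁)) refl

p*p≥0 : ∀ p → 0ℚ Q.≤ p Q.* p
p*p≥0 p with ℚ.≤-total p 0ℚ
... | inj₁ p≤0 = ℚ.nonNegative⁻¹ _ {{ℚ.nonPos*nonPos⇒nonPos p {{Q.nonPositive p≤0}} p {{Q.nonPositive p≤0}}}}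
... | inj₂ 0≤p = ℚ.nonNegative⁻¹ _ {{ℚ.nonNeg*nonNeg⇒nonNeg p {{Q.nonNegative 0≤p}} p {{Q.nonNegative 0≤p}}}}

p*q≡0⇒q≡0 : ∀ {p q} → p ≢ 0ℚ → p Q.* q ≡ 0ℚ → q ≡ 0ℚ
p*q≡0⇒q≡0 {p} {q} p≢0 p*q≡0 = begin
  q                      ≡⟨ sym (ℚ.*-identityˡ q) ⟩
  1ℚ Q.* q               ≡⟨ cong (Q._* q) (sym (ℚ.*-inverseˡ p)) ⟩
  (Q.1/ p Q.* p) Q.* q   ≡⟨ ℚ.*-assoc (Q.1/ p) p q ⟩
  Q.1/ p Q.* (p Q.* q)   ≡⟨ cong (Q.1/ p Q.*_) p*q≡0 ⟩
  Q.1/ p Q.* 0ℚ          ≡⟨ ℚ.*-zeroʳ (Q.1/ p) ⟩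
  0ℚ                     ∎
  where
  open ≡-Reasoning
  instance _ = Q.≢-nonZero p≢0

x²+x+2≢0 : ∀ a → a Q.* a Q.+ a Q.+ 2ℚ ≢ 0ℚ
x²+x+2≢0 a x²+x+2≡0 = ℚ.<⇒≢ 0<x²+x+2 (sym x²+x+2≡0)
  where
  open +-*-Solver using (solve; _:=_)
  7/4 : ℚ
  7/4 = + 7 Q./ 4
  completed-square : a Q.* a Q.+ a Q.+ 2ℚ ≡ (a Q.+ ½) Q.* (a Q.+ ½) Q.+ 7/4
  completed-square = solve 1 (λ x → x :* x :+ x :+ con 2ℚ := (x :+ con ½) :* (x :+ con ½) :+ con 7/4) refl a
  0<x²+x+2 : 0ℚ Q.< a Q.* a Q.+ a Q.+ 2ℚ
  0<x²+x+2 = subst (0ℚ Q.<_) (sym completed-square) (ℚ.+-mono-≤-< (p*p≥0 (a Q.+ ½)) (ℚ.positive⁻¹ 7/4))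

real-if-scaled-real : ∀ {t c} y → t ≢ 0ℚ → t · y + scalar c ≡ 𝟘 → y ≡ scalar (re y)
real-if-scaled-real {t} y t≢0 t·y+c≡0 =
  cong₂ oct (quat-cong refl (vanishes (cong (ℍ.ii ∘ 𝕆.fst) t·y+c≡0))
                            (vanishes (cong (ℍ.jj ∘ 𝕆.fst) t·y+c≡0))
                            (vanishes (cong (ℍ.kk ∘ 𝕆.fst) t·y+c≡0)))
            (quat-cong (vanishes (cong (ℍ.re ∘ 𝕆.snd) t·y+c≡0))
                       (vanishes (cong (ℍ.ii ∘ 𝕆.snd) t·y+c≡0))
                       (vanishes (cong (ℍ.jj ∘ 𝕆.snd) t·y+c≡0))
                       (vanishes (cong (ℍ.kk ∘ 𝕆.snd) t·y+c≡0)))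
  where
  vanishes : ∀ {q} → t Q.* q Q.+ 0ℚ ≡ 0ℚ → q ≡ 0ℚ
  vanishes {q} t*q+0≡0 = p*q≡0⇒q≡0 t≢0 (trans (sym (ℚ.+-identityʳ (t Q.* q))) t*q+0≡0)

trace-norm-of-root : ∀ y → y * y + y + 𝟚 ≡ 𝟘 → tr y ≡ Q.- 1ℚ × N y ≡ 2ℚ
trace-norm-of-root y root with tr y Q.+ 1ℚ ≟ 0ℚ
... | yes tr+1≡0 = x∙y⁻¹≈ε⇒x≈y (tr y) (Q.- 1ℚ) tr+1≡0 , sym (x∙y⁻¹≈ε⇒x≈y 2ℚ (N y) 2-N≡0)
  where
  2-N≡0 : 2ℚ Q.- N y ≡ 0ℚ
  2-N≡0 = begin
    2ℚ Q.- N y                                ≡⟨ sym (ℚ.+-identityˡ _) ⟩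
    0ℚ Q.+ (2ℚ Q.- N y)                       ≡⟨ cong (Q._+ (2ℚ Q.- N y)) (sym (ℚ.*-zeroˡ (re y))) ⟩
    0ℚ Q.* re y Q.+ (2ℚ Q.- N y)              ≡⟨ cong (λ t → t Q.* re y Q.+ (2ℚ Q.- N y)) (sym tr+1≡0) ⟩
    (tr y Q.+ 1ℚ) Q.* re y Q.+ (2ℚ Q.- N y)   ≡⟨ cong re (trans (sym (y²+y+2≡[tr+1]y+[2-N] y)) root) ⟩
    0ℚ                                        ∎
    where open ≡-Reasoning
... | no tr+1≢0 = ⊥-elim (x²+x+2≢0 (re y) (cong re real-root))
  where
  y≡re : y ≡ scalar (re y)
  y≡re = real-if-scaled-real y tr+1≢0 (trans (sym (y²+y+2≡[tr+1]y+[2-N] y)) root)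
  real-root : scalar (re y Q.* re y Q.+ re y Q.+ 2ℚ) ≡ 𝟘
  real-root = begin
    scalar (re y Q.* re y Q.+ re y Q.+ 2ℚ)
      ≡⟨ cong (λ s → s + scalar (re y) + 𝟚) (sym (scalar-* (re y) (re y))) ⟩
    scalar (re y) * scalar (re y) + scalar (re y) + 𝟚
      ≡⟨ cong (λ w → w * w + w + 𝟚) (sym y≡re) ⟩
    y * y + y + 𝟚
      ≡⟨ root ⟩
    𝟘 ∎
    where open ≡-Reasoning

module TraceNorm (λ₀ : 𝕆) (tr≡-1 : tr λ₀ ≡ Q.- 1ℚ) (N≡2 : N λ₀ ≡ 2ℚ) where

  λ̄≡-1-λ : conj λ₀ ≡ - 𝟙 - λ₀
  λ̄≡-1-λ = trans (ȳ≡tr-y λ₀) (cong (λ t → scalar t - λ₀) tr≡-1)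

  λ̄+λ≡-1 : conj λ₀ + λ₀ ≡ - 𝟙
  λ̄+λ≡-1 = trans (ȳ+y≡tr λ₀) (cong scalar tr≡-1)

  x*λ*λ̄≡x*2 : ∀ x → x * λ₀ * conj λ₀ ≡ x * 𝟚
  x*λ*λ̄≡x*2 x = trans (x*y*ȳ≡x*Ny x λ₀) (cong (λ q → x * scalar q) N≡2)

  x*λ̄*λ≡x*2 : ∀ x → x * conj λ₀ * λ₀ ≡ x * 𝟚
  x*λ̄*λ≡x*2 x = trans (x*ȳ*y≡x*Ny x λ₀) (cong (λ q → x * scalar q) N≡2)

  𝖮λ∩𝖮λ̄⊆𝖮2 : ∀ {z} → z ∈𝖮· λ₀ → z ∈𝖮· conj λ₀ → z ∈𝖮· 𝟚
  𝖮λ∩𝖮λ̄⊆𝖮2 {z} (a , a∈𝖮 , z≡aλ) (b , b∈𝖮 , z≡bλ̄) = - (a + b) , neg (add a∈𝖮 b∈𝖮) , (begin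
    z                         ≡⟨ sym (*-identityʳ z) ⟩
    z * 𝟙                     ≡⟨ cong (λ w → z * - w) (sym λ̄+λ≡-1) ⟩
    z * - (conj λ₀ + λ₀)      ≡⟨ sym (-‿distribʳ-* z (conj λ₀ + λ₀)) ⟩
    - (z * (conj λ₀ + λ₀))    ≡⟨ cong -_ (*-distribˡ-+ z (conj λ₀) λ₀) ⟩
    - (z * conj λ₀ + z * λ₀)  ≡⟨ cong₂ (λ u v → - (u + v)) zλ̄≡a2 zλ≡b2 ⟩
    - (a * 𝟚 + b * 𝟚)         ≡⟨ cong -_ (sym (*-distribʳ-+ a b 𝟚)) ⟩
    - ((a + b) * 𝟚)           ≡⟨ -‿distribˡ-* (a + b) 𝟚 ⟩
    - (a + b) * 𝟚             ∎)
    where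
    open ≡-Reasoning
    zλ̄≡a2 : z * conj λ₀ ≡ a * 𝟚
    zλ̄≡a2 = trans (cong (_* conj λ₀) z≡aλ) (x*λ*λ̄≡x*2 a)
    zλ≡b2 : z * λ₀ ≡ b * 𝟚
    zλ≡b2 = trans (cong (_* λ₀) z≡bλ̄) (x*λ̄*λ≡x*2 b)

  𝖮2⊆𝖮λ∩𝖮λ̄ : InO λ₀ → ∀ {z} → z ∈𝖮· 𝟚 → z ∈𝖮· λ₀ × z ∈𝖮· conj λ₀
  𝖮2⊆𝖮λ∩𝖮λ̄ λ₀∈𝖮 (x , x∈𝖮 , z≡x2) =
    (x * conj λ₀ , mul x∈𝖮 λ̄∈𝖮 , trans z≡x2 (sym (x*λ̄*λ≡x*2 x))) ,
    (x * λ₀ , mul x∈𝖮 λ₀∈𝖮 , trans z≡x2 (sym (x*λ*λ̄≡x*2 x)))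
    where
    λ̄∈𝖮 : InO (conj λ₀)
    λ̄∈𝖮 = subst InO (sym λ̄≡-1-λ) (add (neg one) (neg λ₀∈𝖮))

mainTheorem6 : (λ₀ : 𝕆) → InO λ₀ → λ₀ * λ₀ + λ₀ + 𝟚 ≡ 𝟘 →
    (z : 𝕆) → ((z ∈𝖮· λ₀) × (z ∈𝖮· conj λ₀)) ⇔ (z ∈𝖮· 𝟚)
mainTheorem6 λ₀ λ₀∈𝖮 root z = mk⇔ (uncurry 𝖮λ∩𝖮λ̄⊆𝖮2) (𝖮2⊆𝖮λ∩𝖮λ̄ λ₀∈𝖮)
  where
  open TraceNorm λ₀ (proj₁ (trace-norm-of-root λ₀ root)) (proj₂ (trace-norm-of-root λ₀ root))
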